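{- Let $Z$ be a nonempty finite subset of $\omega$ and let $\Gamma\Rightarrow\Delta$ be a $Z$-saturated sequent over a language whose set of variables is $V$. Let $\mathfrak M_{(\Gamma,\Delta)}=(Z,V,\mathfrak J_{(\Gamma,\Delta)})$ be the relational information model with worlds $Z$, domain $V$, and $(x_1,\dots,x_m)\in\mathfrak J_{(\Gamma,\Delta)}(P,k)$ iff $\{k\}:P(x_1,\dots,x_m)\notin\Delta$. Let $\mathtt{id}:V\to V$ be the identity assignment. Then for every labelled formula $X:\varphi$: (i) if $X:\varphi\in\Gamma$ then $\mathfrak M_{(\Gamma,\Delta)},X\Vdash_{\mathtt{id}}\varphi$; (ii) if $X:\varphi\in\Delta$ then $\mathfrak M_{(\Gamma,\Delta)},X\not\Vdash_{\mathtt{id}}\varphi$.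
   Context: Language: countably infinite set $V$ of variables, countably infinite set of predicate symbols with arities (no identity, constants, function symbols). Formulas: $\varphi ::= P(x_1,\dots,x_m)\mid \bot\mid \varphi\to\varphi\mid\varphi\wedge\varphi\mid \varphi\veebar\varphi\mid \forall x\varphi\mid \bar\exists x\varphi$ ($\veebar$ inquisitive disjunction, $\bar\exists$ inquisitive existential). $\varphi[z/x]$ is capture-avoiding substitution. Semantics: a relational information model $\mathfrak M=(W,D,\mathfrak I)$ has nonempty $W$, nonempty $D$, $\mathfrak I(P,w)\subseteq D^m$; for states $s\subseteq W$ and $g:V\to D$: $s\Vdash_g P(\bar x)$ iff $g(\bar x)\in\mathfrak I(P,w)$ for all $w\in s$; $s\Vdash_g\bot$ iff $s=\varnothing$; $\wedge$ pointwise; $s\Vdash_g\varphi\to\psi$ iff every $t\subseteq s$ supporting $\varphi$ supports $\psi$; $s\Vdash_g\varphi\veebar\psi$ iff $s\Vdash_g\varphi$ or $s\Vdash_g\psi$; $\forall x$ / $\bar\exists x$: for all / some $d\in D$, $s\Vdash_{g[x\mapsto d]}\varphi$. Calculus $\mathbf{G}(\mathsf{FBInqBQ})$: a label is a nonempty finite subset of $\omega$; a labelled formula is $X:\varphi$; a finite sequent is a pair of finite multisets of labelled formulas. Initial sequents: $(\mathtt{id})$ $X:P(\bar x),\Gamma\Rightarrow\Delta,Y:P(\bar x)$ whenever $X\supseteq Y$; $(\bot\Rightarrow)$ $X:\bot,\Gamma\Rightarrow\Delta$. Rules (premises / conclusion): $(\Rightarrow\mathtt{at})$: $\Gamma\Rightarrow\Delta,\{k\}:P(\bar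 x)$ for every $k\in X$ / $\Gamma\Rightarrow\Delta,X:P(\bar x)$. $(\Rightarrow\wedge)$: $\Gamma\Rightarrow\Delta,X:\varphi$ and $\Gamma\Rightarrow\Delta,X:\psi$ / $\Gamma\Rightarrow\Delta,X:\varphi\wedge\psi$. $(\wedge\Rightarrow)$: $X:\varphi,X:\psi,\Gamma\Rightarrow\Delta$ / $X:\varphi\wedge\psi,\Gamma\Rightarrow\Delta$. $(\Rightarrow\veebar)$: $\Gamma\Rightarrow\Delta,X:\varphi,X:\psi$ / $\Gamma\Rightarrow\Delta,X:\varphi\veebar\psi$. $(\veebar\Rightarrow)$: $X:\varphi,\Gamma\Rightarrow\Delta$ and $X:\psi,\Gamma\Rightarrow\Delta$ / $X:\varphi\veebar\psi,\Gamma\Rightarrow\Delta$. $(\Rightarrow\to)$: $Y:\varphi,\Gamma\Rightarrow\Delta,Y:\psi$ for every label $Y\subseteq X$ / $\Gamma\Rightarrow\Delta,X:\varphi\to\psi$. $(\to\Rightarrow)$, for a label $Y\subseteq X$: $X:\varphi\to\psi,\Gamma\Rightarrow\Delta,Y:\varphi$ and $Y:\psi,X:\varphi\to\psi,\Gamma\Rightarrow\Delta$ / $X:\varphi\to\psi,\Gamma\Rightarrow\Delta$. $(\Rightarrow\forall)$: $\Gamma\Rightarrow\Delta,X:\varphi[z/x]$ / $\Gamma\Rightarrow\Delta,X:\forall x\varphi$, $z$ not in the conclusion. $(\forall\Rightarrow)$: $X:\varphi[y/x],X:\forall x\varphi,\Gamma\Rightarrow\Delta$ / $X:\forall x\varphi,\Gamma\Rightarrow\Delta$.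 $(\Rightarrow\bar\exists)$: $\Gamma\Rightarrow\Delta,X:\bar\exists x\varphi,X:\varphi[y/x]$ / $\Gamma\Rightarrow\Delta,X:\bar\exists x\varphi$. $(\bar\exists\Rightarrow)$: $X:\varphi[z/x],\Gamma\Rightarrow\Delta$ / $X:\bar\exists x\varphi,\Gamma\Rightarrow\Delta$, $z$ not in the conclusion. A possibly infinite sequent (pair of possibly infinite sets of labelled formulas) is derivable if some finite subsequent is the root of a derivation. $Z$-saturation: $\Gamma\Rightarrow\Delta$ is $Z$-saturated if all its labels are subsets of $Z$ and: it is not derivable; if $X:P(\bar x)\in\Delta$ then $\{k\}:P(\bar x)\in\Delta$ for some $k\in X$; if $X:\varphi_1\wedge\varphi_2\in\Delta$ then $X:\varphi_1\in\Delta$ or $X:\varphi_2\in\Delta$; if $X:\varphi_1\wedge\varphi_2\in\Gamma$ then $X:\varphi_1,X:\varphi_2\in\Gamma$; if $X:\varphi_1\veebar\varphi_2\in\Delta$ then $X:\varphi_1,X:\varphi_2\in\Delta$; if $X:\varphi_1\veebar\varphi_2\in\Gamma$ then $X:\varphi_1\in\Gamma$ or $X:\varphi_2\in\Gamma$; if $X:\varphi_1\to\varphi_2\in\Delta$ then for some label $Y\subseteq X$, $Y:\varphi_1\in\Gamma$ and $Y:\varphi_2\in\Delta$; if $X:\varphi_1\to\varphi_2\in\Gamma$ then for every label $Y\subseteq X$, $Y:\varphi_1\in\Delta$ or $Y:\varphi_2\in\Gamma$; if $X:\forall x\varphi\in\Delta$ then $X:\varphi[z/x]\in\Delta$ for some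 $z\in V$; if $X:\forall x\varphi\in\Gamma$ then $X:\varphi[y/x]\in\Gamma$ for all $y\in V$; if $X:\bar\exists x\varphi\in\Delta$ then $X:\varphi[y/x]\in\Delta$ for all $y\in V$; if $X:\bar\exists x\varphi\in\Gamma$ then $X:\varphi[z/x]\in\Gamma$ for some $z\in V$. -}

module Defs where

open import Level using (Lift; 0ℓ) renaming (suc to lsuc)
open import Data.Nat using (ℕ; zero; suc; _<_; _⊔_; _≟_)
open import Data.Bool using (if_then_else_)
open import Data.List using (List; []; _∷_; _++_; map; filter; foldr)
open import Data.Bool.ListAction using (any)
open import Data.List.Relation.Unary.Any using (here)
open import Data.List.Membership.Propositional using (_∈_; _∉_)
open import Data.List.Relation.Unary.All using (All)
open import Data.List.Relation.Unary.Linked using (Linked; [-])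
open import Data.List.Relation.Binary.Permutation.Propositional using (_↭_)
open import Data.Vec using (Vec)
import Data.Vec as Vec
open import Data.Product using (Σ; _×_; _,_; proj₁; ∃)
open import Data.Sum using (_⊎_)
open import Data.Empty using (⊥)
open import Relation.Nullary using (¬_; ¬?)
open import Relation.Nullary.Decidable using (⌊_⌋)
open import Relation.Binary.PropositionalEquality using (_≡_; refl)

-- Variables: V = ℕ.  Predicate symbols: a name together with an arity
-- (countably many of every arity).
record Pred : Set where
  constructor pred
  field
    name  : ℕ
    arity : ℕ
open Pred public

infixr 6 _∧'_ _⩒_
infixr 5 _⇒_

data Formula : Set where
  atom : (P : Pred) → Vec ℕ (arity P) → Formula
  ⊥'   : Formula
  _⇒_  : Formula → Formula → Formula
  _∧'_ : Formula → Formula → Formula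
  _⩒_  : Formula → Formula → Formula
  ∀'   : ℕ → Formula → Formula
  ∃'   : ℕ → Formula → Formula

fv : Formula → List ℕ
fv (atom P xs) = Vec.toList xs
fv ⊥'          = []
fv (φ ⇒ ψ)     = fv φ ++ fv ψ
fv (φ ∧' ψ)    = fv φ ++ fv ψ
fv (φ ⩒ ψ)     = fv φ ++ fv ψ
fv (∀' y φ)    = filter (λ u → ¬? (u ≟ y)) (fv φ)
fv (∃' y φ)    = filter (λ u → ¬? (u ≟ y)) (fv φ)

_[_↦_] : {A : Set} → (ℕ → A) → ℕ → A → ℕ → A
(σ [ y ↦ w ]) u = if ⌊ u ≟ y ⌋ then w else σ u

maxL : List ℕ → ℕ
maxL = foldr _⊔_ 0

-- Capture-avoiding simultaneous renaming (Stoughton style): the bound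
-- variable y is kept unless some free variable of the quantified formula
-- is mapped onto y, in which case it is renamed to a variable strictly
-- larger than all images of the free variables.
binder : (ℕ → ℕ) → ℕ → Formula → ℕ
binder σ y φ =
  if any (λ u → ⌊ σ u ≟ y ⌋) (fv φ')
  then suc (maxL (map σ (fv φ')))
  else y
  where φ' = ∀' y φ

rename : (ℕ → ℕ) → Formula → Formula
rename σ (atom P xs) = atom P (Vec.map σ xs)
rename σ ⊥'          = ⊥'
rename σ (φ ⇒ ψ)     = rename σ φ ⇒ rename σ ψ
rename σ (φ ∧' ψ)    = rename σ φ ∧' rename σ ψ
rename σ (φ ⩒ ψ)     = rename σ φ ⩒ rename σ ψ
rename σ (∀' y φ)    = ∀' (binder σ y φ) (rename (σ [ y ↦ binder σ y φ ]) φ)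
rename σ (∃' y φ)    = ∃' (binder σ y φ) (rename (σ [ y ↦ binder σ y φ ]) φ)

_[_/_] : Formula → ℕ → ℕ → Formula
φ [ z / x ] = rename ((λ u → u) [ x ↦ z ]) φ

-- Labels: nonempty finite subsets of ω, represented canonically as
-- strictly increasing nonempty lists (the sortedness proof is irrelevant,
-- so equal element lists give equal labels).

record Label : Set where
  constructor label
  field
    least  : ℕ
    others : List ℕ
    .sorted : Linked _<_ (least ∷ others)
open Label public

elems : Label → List ℕ
elems X = least X ∷ others X

_∈L_ : ℕ → Label → Set
k ∈L X = k ∈ elems X

_⊆L_ : Label → Label → Set
Y ⊆L X = ∀ k → k ∈L Y → k ∈L X

single : ℕ → Label
single k = label k [] [-]

LF : Set
LF = Label × Formula

-- The calculus G(FBInqBQ) on finite sequents (multisets of labelled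
-- formulas, represented as lists up to permutation).

fvLs : List LF → List ℕ
fvLs []             = []
fvLs ((X , φ) ∷ Γ)  = fv φ ++ fvLs Γ

infix 3 _⊢_

data _⊢_ : List LF → List LF → Set where
  exch : ∀ {Γ Γ' Δ Δ'} → Γ ↭ Γ' → Δ ↭ Δ' → Γ ⊢ Δ → Γ' ⊢ Δ'
  id   : ∀ {X Y P xs Γ Δ} → Y ⊆L X →
         (X , atom P xs) ∷ Γ ⊢ (Y , atom P xs) ∷ Δ
  ⊥L   : ∀ {X Γ Δ} → (X , ⊥') ∷ Γ ⊢ Δ
  Rat  : ∀ {X P xs Γ Δ} →
         (∀ k → k ∈L X → Γ ⊢ (single k , atom P xs) ∷ Δ) →
         Γ ⊢ (X , atom P xs) ∷ Δ
  R∧   : ∀ {X φ ψ Γ Δ} → Γ ⊢ (X , φ) ∷ Δ → Γ ⊢ (X , ψ) ∷ Δ →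
         Γ ⊢ (X , φ ∧' ψ) ∷ Δ
  L∧   : ∀ {X φ ψ Γ Δ} → (X , φ) ∷ (X , ψ) ∷ Γ ⊢ Δ →
         (X , φ ∧' ψ) ∷ Γ ⊢ Δ
  R⩒   : ∀ {X φ ψ Γ Δ} → Γ ⊢ (X , φ) ∷ (X , ψ) ∷ Δ →
         Γ ⊢ (X , φ ⩒ ψ) ∷ Δ
  L⩒   : ∀ {X φ ψ Γ Δ} → (X , φ) ∷ Γ ⊢ Δ → (X , ψ) ∷ Γ ⊢ Δ →
         (X , φ ⩒ ψ) ∷ Γ ⊢ Δ
  R⇒   : ∀ {X φ ψ Γ Δ} →
         (∀ Y → Y ⊆L X → (Y , φ) ∷ Γ ⊢ (Y , ψ) ∷ Δ) →
         Γ ⊢ (X , φ ⇒ ψ) ∷ Δ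
  L⇒   : ∀ {X Y φ ψ Γ Δ} → Y ⊆L X →
         (X , φ ⇒ ψ) ∷ Γ ⊢ (Y , φ) ∷ Δ →
         (Y , ψ) ∷ (X , φ ⇒ ψ) ∷ Γ ⊢ Δ →
         (X , φ ⇒ ψ) ∷ Γ ⊢ Δ
  R∀   : ∀ {X x z φ Γ Δ} → z ∉ fvLs ((X , ∀' x φ) ∷ Γ ++ Δ) →
         Γ ⊢ (X , φ [ z / x ]) ∷ Δ →
         Γ ⊢ (X , ∀' x φ) ∷ Δ
  L∀   : ∀ {X x y φ Γ Δ} →
         (X , φ [ y / x ]) ∷ (X , ∀' x φ) ∷ Γ ⊢ Δ →
         (X , ∀' x φ) ∷ Γ ⊢ Δ
  R∃   : ∀ {X x y φ Γ Δ} →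
         Γ ⊢ (X , ∃' x φ) ∷ (X , φ [ y / x ]) ∷ Δ →
         Γ ⊢ (X , ∃' x φ) ∷ Δ
  L∃   : ∀ {X x z φ Γ Δ} → z ∉ fvLs ((X , ∃' x φ) ∷ Γ ++ Δ) →
         (X , φ [ z / x ]) ∷ Γ ⊢ Δ →
         (X , ∃' x φ) ∷ Γ ⊢ Δ

-- possibly infinite sequents: pairs of sets (predicates) of labelled formulas
Derivable : (Γ Δ : LF → Set) → Set
Derivable Γ Δ = Σ (List LF) λ Γf → Σ (List LF) λ Δf →
  All Γ Γf × All Δ Δf × (Γf ⊢ Δf)

record Saturated (Z : Label) (Γ Δ : LF → Set) : Set where
  field
    labelsΓ : ∀ X φ → Γ (X , φ) → X ⊆L Z
    labelsΔ : ∀ X φ → Δ (X , φ) → X ⊆L Z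
    underivable : ¬ Derivable Γ Δ
    atΔ  : ∀ X P xs → Δ (X , atom P xs) →
           Σ ℕ λ k → k ∈L X × Δ (single k , atom P xs)
    ∧Δ   : ∀ X φ ψ → Δ (X , φ ∧' ψ) → Δ (X , φ) ⊎ Δ (X , ψ)
    ∧Γ   : ∀ X φ ψ → Γ (X , φ ∧' ψ) → Γ (X , φ) × Γ (X , ψ)
    ⩒Δ   : ∀ X φ ψ → Δ (X , φ ⩒ ψ) → Δ (X , φ) × Δ (X , ψ)
    ⩒Γ   : ∀ X φ ψ → Γ (X , φ ⩒ ψ) → Γ (X , φ) ⊎ Γ (X , ψ)
    ⇒Δ   : ∀ X φ ψ → Δ (X , φ ⇒ ψ) →
           Σ Label λ Y → Y ⊆L X × Γ (Y , φ) × Δ (Y , ψ)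
    ⇒Γ   : ∀ X φ ψ → Γ (X , φ ⇒ ψ) →
           ∀ Y → Y ⊆L X → Δ (Y , φ) ⊎ Γ (Y , ψ)
    ∀Δ   : ∀ X x φ → Δ (X , ∀' x φ) → Σ ℕ λ z → Δ (X , φ [ z / x ])
    ∀Γ   : ∀ X x φ → Γ (X , ∀' x φ) → ∀ y → Γ (X , φ [ y / x ])
    ∃Δ   : ∀ X x φ → Δ (X , ∃' x φ) → ∀ y → Δ (X , φ [ y / x ])
    ∃Γ   : ∀ X x φ → Γ (X , ∃' x φ) → Σ ℕ λ z → Γ (X , φ [ z / x ])

record Model : Set₁ where
  field
    W  : Set
    D  : Set
    w₀ : W
    d₀ : D
    I  : (P : Pred) → W → Vec D (arity P) → Set
open Model public

_,_⊩[_]_ : (M : Model) → (W M → Set) → (ℕ → D M) → Formula → Set₁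
M , s ⊩[ g ] atom P xs = Lift (lsuc 0ℓ) (∀ w → s w → I M P w (Vec.map g xs))
M , s ⊩[ g ] ⊥'        = Lift (lsuc 0ℓ) (∀ w → ¬ s w)
M , s ⊩[ g ] (φ ⇒ ψ)   = ∀ (t : W M → Set) → (∀ w → t w → s w) →
                           M , t ⊩[ g ] φ → M , t ⊩[ g ] ψ
M , s ⊩[ g ] (φ ∧' ψ)  = (M , s ⊩[ g ] φ) × (M , s ⊩[ g ] ψ)
M , s ⊩[ g ] (φ ⩒ ψ)   = (M , s ⊩[ g ] φ) ⊎ (M , s ⊩[ g ] ψ)
M , s ⊩[ g ] ∀' x φ    = ∀ (d : D M) → M , s ⊩[ g [ x ↦ d ] ] φ
M , s ⊩[ g ] ∃' x φ    = Σ (D M) λ d → M , s ⊩[ g [ x ↦ d ] ] φ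

canonical : (Z : Label) (Γ Δ : LF → Set) → Model
canonical Z Γ Δ = record
  { W  = Σ ℕ λ k → k ∈L Z
  ; D  = ℕ
  ; w₀ = least Z , here refl
  ; d₀ = 0
  ; I  = λ P w xs → ¬ Δ (single (proj₁ w) , atom P xs)
  }

stateOf : (Z : Label) → Label → Σ ℕ (λ k → k ∈L Z) → Set
stateOf Z X w = proj₁ w ∈L X

idAsg : ℕ → ℕ
idAsg u = u

{-# OPTIONS --safe #-}
-- Induction on formula size (renaming preserves size), for both sides at once
-- and closed under substates: if X:φ ∈ Γ then every substate of X supports φ,
-- and if X:φ ∈ Δ then every substate of X supporting φ omits some world of X.
-- The latter, constructive, form of "X does not support φ" is what the case of
-- an implication in Γ needs. Quantifiers go through the substitution lemma
-- s ⊩_g φ[z/x] ⇔ s ⊩_{g[x ↦ g z]} φ, which rests on the freshness of the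
-- binder chosen by capture-avoiding renaming.
module Submission where

open import Defs
open import Data.Nat using (ℕ; suc; _<_; _≤_; _≟_; _+_; s≤s)
open import Data.Nat.Properties using (≤-trans; ≤-reflexive; m≤m+n; m≤n+m; m≤m⊔n; m≤n⊔m; <⇒≢; <-trans)
open import Data.Nat.Induction using (<-wellFounded)
open import Data.Bool using (true; false; T)
open import Data.Bool.ListAction using (any)
open import Data.List using ([]; _∷_; filter; length)
open import Data.List.Properties using (filter-notAll)
open import Data.List.Relation.Unary.Any using (here; there)
import Data.List.Relation.Unary.Any as Any
open import Data.List.Relation.Unary.Any.Properties using (any⁺)
open import Data.List.Relation.Unary.All using (_∷_; [])
open import Data.List.Relation.Unary.Linked using (Linked)
open import Data.List.Relation.Unary.Linked.Properties using (filter⁺)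
open import Data.List.Membership.Propositional using (_∈_; lose)
open import Data.List.Membership.Propositional.Properties using (∈-map⁺; ∈-filter⁺; ∈-filter⁻; ∈-++⁺ˡ; ∈-++⁺ʳ)
open import Data.Vec using (Vec)
import Data.Vec as Vec
open import Data.Vec.Properties using (map-∘; map-id)
open import Data.Product using (Σ; _×_; _,_; proj₁; proj₂)
open import Data.Product.Function.NonDependent.Propositional using (_×-⇔_)
open import Data.Sum using (inj₁; inj₂)
open import Data.Sum.Function.Propositional using (_⊎-⇔_)
open import Function.Base using (_on_; case_of_)
open import Function.Bundles using (_⇔_; mk⇔; Equivalence)
import Function.Properties.Equivalence as ⇔
open import Induction.WellFounded using (WfRec; module All)
open import Level using (Lift; lift; lower)
import Relation.Binary.Construct.On as On
open import Relation.Nullary using (¬_; ¬?; yes; no; contradiction)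
open import Relation.Unary using (Decidable)
open import Relation.Nullary.Decidable using (⌊_⌋; fromWitness)
open import Relation.Binary.PropositionalEquality using (_≡_; _≢_; refl; sym; trans; cong; cong₂; subst; module ≡-Reasoning)

open Equivalence using (to; from)

update-≡ : ∀ {A : Set} (f : ℕ → A) y w → (f [ y ↦ w ]) y ≡ w
update-≡ f y w with y ≟ y
... | yes _   = refl
... | no y≢y = contradiction refl y≢y

update-≢ : ∀ {A : Set} (f : ℕ → A) {y} w {u} → u ≢ y → (f [ y ↦ w ]) u ≡ f u
update-≢ f {y} w {u} u≢y with u ≟ y
... | yes u≡y = contradiction u≡y u≢y
... | no _    = refl

∈⇒≤maxL : ∀ {x xs} → x ∈ xs → x ≤ maxL xs
∈⇒≤maxL {xs = y ∷ ys} (here refl) = m≤m⊔n y (maxL ys)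
∈⇒≤maxL {xs = y ∷ ys} (there x∈ys) = ≤-trans (∈⇒≤maxL x∈ys) (m≤n⊔m y (maxL ys))

binder-fresh : ∀ σ y φ {u} → u ∈ fv (∀' y φ) → σ u ≢ binder σ y φ
binder-fresh σ y φ {u} u∈fv with any (λ v → ⌊ σ v ≟ y ⌋) (fv (∀' y φ)) in clash
... | true  = <⇒≢ (s≤s (∈⇒≤maxL (∈-map⁺ σ u∈fv)))
... | false = λ σu≡y → subst T clash (any⁺ _ (lose u∈fv (fromWitness σu≡y)))

size : Formula → ℕ
size (atom P xs) = 1
size ⊥'          = 1
size (φ ⇒ ψ)     = suc (size φ + size ψ)
size (φ ∧' ψ)    = suc (size φ + size ψ)
size (φ ⩒ ψ)     = suc (size φ + size ψ)
size (∀' x φ)    = suc (size φ)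
size (∃' x φ)    = suc (size φ)

sizeˡ : ∀ φ ψ → size φ < suc (size φ + size ψ)
sizeˡ φ ψ = s≤s (m≤m+n (size φ) (size ψ))

sizeʳ : ∀ φ ψ → size ψ < suc (size φ + size ψ)
sizeʳ φ ψ = s≤s (m≤n+m (size ψ) (size φ))

size-rename : ∀ σ φ → size (rename σ φ) ≡ size φ
size-rename σ (atom P xs) = refl
size-rename σ ⊥'          = refl
size-rename σ (φ ⇒ ψ)     = cong₂ (λ m n → suc (m + n)) (size-rename σ φ) (size-rename σ ψ)
size-rename σ (φ ∧' ψ)    = cong₂ (λ m n → suc (m + n)) (size-rename σ φ) (size-rename σ ψ)
size-rename σ (φ ⩒ ψ)     = cong₂ (λ m n → suc (m + n)) (size-rename σ φ) (size-rename σ ψ)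
size-rename σ (∀' y φ)    = cong suc (size-rename _ φ)
size-rename σ (∃' y φ)    = cong suc (size-rename _ φ)

size-[/] : ∀ φ z x → size (φ [ z / x ]) < suc (size φ)
size-[/] φ z x = s≤s (≤-reflexive (size-rename _ φ))

map-cong-∈ : ∀ {A : Set} {n} {f g : ℕ → A} (xs : Vec ℕ n) →
  (∀ u → u ∈ Vec.toList xs → f u ≡ g u) → Vec.map f xs ≡ Vec.map g xs
map-cong-∈ Vec.[]       f≡g = refl
map-cong-∈ (x Vec.∷ xs) f≡g =
  cong₂ Vec._∷_ (f≡g x (here refl)) (map-cong-∈ xs (λ u u∈ → f≡g u (there u∈)))

Agree : {A : Set} → (ℕ → A) → (ℕ → ℕ) → (ℕ → A) → Formula → Set
Agree g σ h φ = ∀ u → u ∈ fv φ → g (σ u) ≡ h u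

agree-binder : ∀ {A : Set} {g h : ℕ → A} σ y φ d → Agree g σ h (∀' y φ) →
  Agree (g [ binder σ y φ ↦ d ]) (σ [ y ↦ binder σ y φ ]) (h [ y ↦ d ]) φ
agree-binder {g = g} {h} σ y φ d agree u u∈fv with u ≟ y
... | yes refl = update-≡ g (binder σ y φ) d
... | no u≢y   = begin
    (g [ binder σ y φ ↦ d ]) (σ u)  ≡⟨ update-≢ g d (binder-fresh σ y φ u∈fv′) ⟩
    g (σ u)                         ≡⟨ agree u u∈fv′ ⟩
    h u                             ∎
  where
  open ≡-Reasoning
  u∈fv′ : u ∈ fv (∀' y φ)
  u∈fv′ = ∈-filter⁺ (λ v → ¬? (v ≟ y)) u∈fv u≢y

module _ (M : Model) where

  ⊩-rename : ∀ φ σ {g h : ℕ → D M} {s : W M → Set} → Agree g σ h φ →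
    (M , s ⊩[ g ] rename σ φ) ⇔ (M , s ⊩[ h ] φ)
  ⊩-rename (atom P xs) σ {g} {h} {s} agree = mk⇔ (subst Holds g∘σ≡h) (subst Holds (sym g∘σ≡h))
    where
    Holds : Vec (D M) (arity P) → Set₁
    Holds ds = Lift _ (∀ w → s w → I M P w ds)
    g∘σ≡h : Vec.map g (Vec.map σ xs) ≡ Vec.map h xs
    g∘σ≡h = trans (sym (map-∘ g σ xs)) (map-cong-∈ xs agree)
  ⊩-rename ⊥' σ agree = ⇔.refl
  ⊩-rename (φ ⇒ ψ) σ agree = mk⇔
    (λ f t t⊆s tφ → to (⊩-rename ψ σ agreeψ) (f t t⊆s (from (⊩-rename φ σ agreeφ) tφ)))
    (λ f t t⊆s tφ → from (⊩-rename ψ σ agreeψ) (f t t⊆s (to (⊩-rename φ σ agreeφ) tφ)))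
    where
    agreeφ = λ u u∈ → agree u (∈-++⁺ˡ u∈)
    agreeψ = λ u u∈ → agree u (∈-++⁺ʳ (fv φ) u∈)
  ⊩-rename (φ ∧' ψ) σ agree = ⊩-rename φ σ agreeφ ×-⇔ ⊩-rename ψ σ agreeψ
    where
    agreeφ = λ u u∈ → agree u (∈-++⁺ˡ u∈)
    agreeψ = λ u u∈ → agree u (∈-++⁺ʳ (fv φ) u∈)
  ⊩-rename (φ ⩒ ψ) σ agree = ⊩-rename φ σ agreeφ ⊎-⇔ ⊩-rename ψ σ agreeψ
    where
    agreeφ = λ u u∈ → agree u (∈-++⁺ˡ u∈)
    agreeψ = λ u u∈ → agree u (∈-++⁺ʳ (fv φ) u∈)
  ⊩-rename (∀' y φ) σ {g} {h} agree = mk⇔ (λ f d → to (body d) (f d)) (λ f d → from (body d) (f d))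
    where body = λ d → ⊩-rename φ _ (agree-binder {g = g} {h} σ y φ d agree)
  ⊩-rename (∃' y φ) σ {g} {h} agree =
    mk⇔ (λ (d , sφ) → d , to (body d) sφ) (λ (d , sφ) → d , from (body d) sφ)
    where body = λ d → ⊩-rename φ _ (agree-binder {g = g} {h} σ y φ d agree)

  ⊩-subst : ∀ φ x z {g : ℕ → D M} {s : W M → Set} →
    (M , s ⊩[ g ] (φ [ z / x ])) ⇔ (M , s ⊩[ g [ x ↦ g z ] ] φ)
  ⊩-subst φ x z {g} = ⊩-rename φ _ agree
    where
    agree : Agree g ((λ u → u) [ x ↦ z ]) (g [ x ↦ g z ]) φ
    agree u _ with u ≟ x
    ... | yes _ = refl
    ... | no _  = refl

  ⊩-empty : ∀ φ {g : ℕ → D M} {s : W M → Set} → (∀ w → ¬ s w) → M , s ⊩[ g ] φ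
  ⊩-empty (atom P xs) s≡∅ = lift λ w sw → contradiction sw (s≡∅ w)
  ⊩-empty ⊥'          s≡∅ = lift s≡∅
  ⊩-empty (φ ⇒ ψ)     s≡∅ = λ t t⊆s _ → ⊩-empty ψ (λ w tw → s≡∅ w (t⊆s w tw))
  ⊩-empty (φ ∧' ψ)    s≡∅ = ⊩-empty φ s≡∅ , ⊩-empty ψ s≡∅
  ⊩-empty (φ ⩒ ψ)     s≡∅ = inj₁ (⊩-empty φ s≡∅)
  ⊩-empty (∀' x φ)    s≡∅ = λ d → ⊩-empty φ s≡∅
  ⊩-empty (∃' x φ)    s≡∅ = d₀ M , ⊩-empty φ s≡∅

card : Label → ℕ
card X = length (elems X)

single⊆ : ∀ {k X} → k ∈L X → single k ⊆L X
single⊆ k∈X _ (here refl) = k∈X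

data Without (Y : Label) (k : ℕ) : Set where
  only    : (∀ j → j ∈L Y → j ≡ k) → Without Y k
  smaller : (Y′ : Label) → card Y′ < card Y → Y′ ⊆L Y →
            (∀ j → j ∈L Y → j ≢ k → j ∈L Y′) → Without Y k

without : ∀ Y k → k ∈L Y → Without Y k
without Y@(label _ _ sorted) k k∈Y = view (filter ≢k? (elems Y)) refl
  where
  ≢k? : Decidable (_≢ k)
  ≢k? u = ¬? (u ≟ k)

  view : ∀ rest → filter ≢k? (elems Y) ≡ rest → Without Y k
  view [] Y∖k≡[] = only λ j j∈Y → case j ≟ k of λ where
    (yes j≡k) → j≡k
    (no j≢k)  → case subst (j ∈_) Y∖k≡[] (∈-filter⁺ ≢k? j∈Y j≢k) of λ ()
  view (x ∷ xs) Y∖k≡x∷xs = smaller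
    (label x xs (subst (Linked _<_) Y∖k≡x∷xs (filter⁺ ≢k? <-trans sorted)))
    (subst (λ l → length l < card Y) Y∖k≡x∷xs
      (filter-notAll ≢k? (elems Y) (Any.map (λ { refl j≢j → j≢j refl }) k∈Y)))
    (λ j j∈ → proj₁ (∈-filter⁻ ≢k? (subst (j ∈_) (sym Y∖k≡x∷xs) j∈)))
    (λ j j∈Y j≢k → subst (j ∈_) Y∖k≡x∷xs (∈-filter⁺ ≢k? j∈Y j≢k))

module TruthLemma {Z : Label} {Γ Δ : LF → Set} (sat : Saturated Z Γ Δ) where
  open Saturated sat

  M : Model
  M = canonical Z Γ Δ

  State : Set₁
  State = W M → Set

  _⊩_ : State → Formula → Set₁
  t ⊩ φ = M , t ⊩[ idAsg ] φ

  _⊆ₛ_ : State → Label → Set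
  t ⊆ₛ X = ∀ w → t w → proj₁ w ∈L X

  _∩ₛ_ : State → Label → State
  (t ∩ₛ Y) w = t w × proj₁ w ∈L Y

  _∉ₛ_ : ℕ → State → Set
  k ∉ₛ t = ∀ k∈Z → ¬ t (k , k∈Z)

  Supported : Label → Formula → Set₁
  Supported X φ = ∀ t → t ⊆ₛ X → t ⊩ φ

  Refuted : Label → Formula → Set₁
  Refuted X φ = ∀ t → t ⊆ₛ X → t ⊩ φ → Σ ℕ λ k → k ∈L X × k ∉ₛ t

  Truth : Formula → Set₁
  Truth φ = (∀ {X} → Γ (X , φ) → Supported X φ) × (∀ {X} → Δ (X , φ) → Refuted X φ)

  atom-¬Γ×Δ : ∀ {X Y P xs} → Y ⊆L X → Γ (X , atom P xs) → ¬ Δ (Y , atom P xs)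
  atom-¬Γ×Δ Y⊆X γ δ = underivable (_ , _ , γ ∷ [] , δ ∷ [] , id Y⊆X)

  ⊥-¬Γ : ∀ {X} → ¬ Γ (X , ⊥')
  ⊥-¬Γ γ = underivable (_ , [] , γ ∷ [] , [] , ⊥L)

  -- Membership in t is undecidable, so t cannot be turned into a label; instead
  -- shrink Y ⊇ t: either Y:ψ ∈ Γ, or Y:φ ∈ Δ and t omits some k ∈ Y, so
  -- t ⊆ Y ∖ {k}, which is smaller or else leaves t empty.
  ⇒-supported : ∀ {X φ ψ} → Γ (X , φ ⇒ ψ) →
    (∀ {Y} → Δ (Y , φ) → Refuted Y φ) → (∀ {Y} → Γ (Y , ψ) → Supported Y ψ) →
    ∀ Y → Y ⊆L X → ∀ t → t ⊆ₛ Y → t ⊩ φ → t ⊩ ψ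
  ⇒-supported {X} {φ} {ψ} γ refutedφ supportedψ =
    All.wfRec (On.wellFounded card <-wellFounded) _ P step
    where
    P : Label → Set₁
    P Y = Y ⊆L X → ∀ t → t ⊆ₛ Y → t ⊩ φ → t ⊩ ψ

    step : ∀ Y → WfRec (_<_ on card) P Y → P Y
    step Y rec Y⊆X t t⊆Y tφ with ⇒Γ X φ ψ γ Y Y⊆X
    ... | inj₂ γψ = supportedψ γψ t t⊆Y
    ... | inj₁ δφ with refutedφ δφ t t⊆Y tφ
    ... | k , k∈Y , k∉t with without Y k k∈Y
    ... | only Y⊆k = ⊩-empty M ψ t-empty
      where
      t-empty : ∀ w → ¬ t w
      t-empty (j , j∈Z) tj with Y⊆k j (t⊆Y _ tj)
      ... | refl = k∉t j∈Z tj
    ... | smaller Y′ Y′<Y Y′⊆Y Y∖k⊆Y′ =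
      rec {Y′} Y′<Y (λ j j∈Y′ → Y⊆X j (Y′⊆Y j j∈Y′)) t t⊆Y′ tφ
      where
      t⊆Y′ : t ⊆ₛ Y′
      t⊆Y′ (j , j∈Z) tj = Y∖k⊆Y′ j (t⊆Y _ tj) λ { refl → k∉t j∈Z tj }

  supported : ∀ φ → WfRec (_<_ on size) Truth φ → ∀ {X} → Γ (X , φ) → Supported X φ
  supported (atom P xs) _ {X} γ t t⊆X = lift λ w tw δ →
    atom-¬Γ×Δ (single⊆ {X = X} (t⊆X w tw)) γ
      (subst (λ ys → Δ (single (proj₁ w) , atom P ys)) (map-id xs) δ)
  supported ⊥' _ γ = contradiction γ ⊥-¬Γ
  supported (φ ⇒ ψ) ih {X} γ t₀ t₀⊆X t t⊆t₀ =
    ⇒-supported γ (proj₂ (ih (sizeˡ φ ψ))) (proj₁ (ih (sizeʳ φ ψ))) X (λ _ k∈X → k∈X)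
      t (λ w tw → t₀⊆X w (t⊆t₀ w tw))
  supported (φ ∧' ψ) ih {X} γ t t⊆X =
    proj₁ (ih (sizeˡ φ ψ)) (proj₁ (∧Γ X φ ψ γ)) t t⊆X ,
    proj₁ (ih (sizeʳ φ ψ)) (proj₂ (∧Γ X φ ψ γ)) t t⊆X
  supported (φ ⩒ ψ) ih {X} γ t t⊆X with ⩒Γ X φ ψ γ
  ... | inj₁ γφ = inj₁ (proj₁ (ih (sizeˡ φ ψ)) γφ t t⊆X)
  ... | inj₂ γψ = inj₂ (proj₁ (ih (sizeʳ φ ψ)) γψ t t⊆X)
  supported (∀' x φ) ih {X} γ t t⊆X d =
    to (⊩-subst M φ x d) (proj₁ (ih (size-[/] φ d x)) (∀Γ X x φ γ d) t t⊆X)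
  supported (∃' x φ) ih {X} γ t t⊆X with ∃Γ X x φ γ
  ... | z , γz = z , to (⊩-subst M φ x z) (proj₁ (ih (size-[/] φ z x)) γz t t⊆X)

  refuted : ∀ φ → WfRec (_<_ on size) Truth φ → ∀ {X} → Δ (X , φ) → Refuted X φ
  refuted (atom P xs) _ {X} δ t t⊆X tP with atΔ X P xs δ
  ... | k , k∈X , δk = k , k∈X , λ k∈Z tk →
    lower tP (k , k∈Z) tk (subst (λ ys → Δ (single k , atom P ys)) (sym (map-id xs)) δk)
  refuted ⊥' _ {X} δ t t⊆X t⊩⊥ = least X , here refl , λ k∈Z tk → lower t⊩⊥ (_ , k∈Z) tk
  refuted (φ ⇒ ψ) ih {X} δ t t⊆X t⊩φ⇒ψ with ⇒Δ X φ ψ δ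
  ... | Y , Y⊆X , γφ , δψ with proj₂ (ih (sizeʳ φ ψ)) δψ (t ∩ₛ Y) (λ _ → proj₂)
                                 (t⊩φ⇒ψ (t ∩ₛ Y) (λ _ → proj₁)
                                   (proj₁ (ih (sizeˡ φ ψ)) γφ (t ∩ₛ Y) (λ _ → proj₂)))
  ... | k , k∈Y , k∉t∩Y = k , Y⊆X k k∈Y , λ k∈Z tk → k∉t∩Y k∈Z (tk , k∈Y)
  refuted (φ ∧' ψ) ih {X} δ t t⊆X (tφ , tψ) with ∧Δ X φ ψ δ
  ... | inj₁ δφ = proj₂ (ih (sizeˡ φ ψ)) δφ t t⊆X tφ
  ... | inj₂ δψ = proj₂ (ih (sizeʳ φ ψ)) δψ t t⊆X tψ
  refuted (φ ⩒ ψ) ih {X} δ t t⊆X (inj₁ tφ) =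
    proj₂ (ih (sizeˡ φ ψ)) (proj₁ (⩒Δ X φ ψ δ)) t t⊆X tφ
  refuted (φ ⩒ ψ) ih {X} δ t t⊆X (inj₂ tψ) =
    proj₂ (ih (sizeʳ φ ψ)) (proj₂ (⩒Δ X φ ψ δ)) t t⊆X tψ
  refuted (∀' x φ) ih {X} δ t t⊆X t⊩∀ with ∀Δ X x φ δ
  ... | z , δz = proj₂ (ih (size-[/] φ z x)) δz t t⊆X (from (⊩-subst M φ x z) (t⊩∀ z))
  refuted (∃' x φ) ih {X} δ t t⊆X (d , tφ) =
    proj₂ (ih (size-[/] φ d x)) (∃Δ X x φ δ d) t t⊆X (from (⊩-subst M φ x d) tφ)

  truth : ∀ φ → Truth φ
  truth = All.wfRec (On.wellFounded size <-wellFounded) _ Truth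
    λ φ ih → supported φ ih , refuted φ ih

lemma3 : (Z : Label) (Γ Δ : LF → Set) → Saturated Z Γ Δ →
    ∀ (X : Label) (φ : Formula) →
      (Γ (X , φ) → canonical Z Γ Δ , stateOf Z X ⊩[ idAsg ] φ) ×
      (Δ (X , φ) → ¬ (canonical Z Γ Δ , stateOf Z X ⊩[ idAsg ] φ))
lemma3 Z Γ Δ sat X φ =
  (λ γ → proj₁ (truth φ) γ (stateOf Z X) X⊆X) ,
  (λ δ X⊩φ → case proj₂ (truth φ) δ (stateOf Z X) X⊆X X⊩φ of λ
    (k , k∈X , k∉X) → k∉X (Saturated.labelsΔ sat X φ δ k k∈X) k∈X)
  where
  open TruthLemma sat
  X⊆X : stateOf Z X ⊆ₛ X
  X⊆X _ k∈X = k∈X
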